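{- Let $(G,R)$ and $(G',R')$ be cyclically ordered groups with Rieger unwounds $uw(G)$, $uw(G')$ and distinguished elements $z_G=(1,e)$, $z_{G'}=(1,e')$. Then $(G,R)\equiv(G',R')$ in the language $L_c=\{\cdot,R,e,^{ -1}\}$ if and only if $(uw(G),\leq_R,\langle z_G\rangle)\equiv(uw(G'),\leq_{R'},\langle z_{G'}\rangle)$ in the language $L_M$ consisting of the group law, the order relation and a unary predicate $M$ interpreted by the subgroup $\langle z_G\rangle$ (resp. $\langle z_{G'}\rangle$). The same holds for elementary inclusion: if $(G,R)$ is a substructure of $(G',R')$ (so $uw(G)\subseteq uw(G')$ canonically and $z_G=z_{G'}$), then $(G,R)\preceq(G',R')$ iff $(uw(G),\langle z_G\rangle)\preceq(uw(G'),\langle z_{G'}\rangle)$ in $L_M$.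
   Context: A cyclic order on a set $A$ is a ternary relation $R$ that is strict ($R(x,y,z)$ implies $x,y,z$ pairwise distinct), total (pairwise distinct $x,y,z$ satisfy $R(x,y,z)$ or $R(x,z,y)$), cyclic ($R(x,y,z)\Rightarrow R(y,z,x)$) and transitive ($R(x,y,z)\wedge R(y,u,z)\Rightarrow R(x,u,z)$). A cyclically ordered group (c.o.g.) is a group with identity $e$ and a cyclic order $R$ with $R(x,y,z)\Rightarrow R(uxv,uyv,uzv)$. The Rieger unwound $uw(G)$ is the set $\mathbb{Z}\times G$ ordered by $(m,g)\leq_R(m',g')$ iff equal or $m<m'$ or ($m=m'$ and ($R(e,g,g')$ or $g=e$)), with group law $(k,e)(m,h)=(k+m,h)$, $(k,g)(m,e)=(k+m,g)$, and for $g,h\neq e$: $(k,g)(m,h)=(k+m,gh)$ if $R(e,g,gh)$, $(k+m+1,gh)$ if $R(e,gh,g)$, $(k+m+1,e)$ if $gh=e$. It is a totally ordered group in which $z_G=(1,e)$ is central and cofinal. -}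

module Defs where

open import Level using (0ℓ)
open import Data.Nat using (ℕ; zero; suc)
open import Data.Fin using (Fin; zero; suc)
open import Data.Integer using (ℤ; _+_; _<_; 1ℤ)
open import Data.Product using (_×_; _,_; Σ)
open import Data.Sum using (_⊎_)
open import Data.Empty using (⊥)
open import Relation.Nullary using (¬_)
open import Relation.Binary.PropositionalEquality using (_≡_; _≢_)
open import Algebra.Structures using (IsGroup)
open import Function.Bundles using (_⇔_)

record CyclicallyOrderedGroup : Set₁ where
  field
    Carrier : Set
    _∙_     : Carrier → Carrier → Carrier
    e       : Carrier
    _⁻¹     : Carrier → Carrier
    isGroup : IsGroup _≡_ _∙_ e _⁻¹
    R       : Carrier → Carrier → Carrier → Set
    strict     : ∀ {x y z} → R x y z → (x ≢ y) × (y ≢ z) × (x ≢ z)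
    total      : ∀ {x y z} → x ≢ y → y ≢ z → x ≢ z → R x y z ⊎ R x z y
    cyclic     : ∀ {x y z} → R x y z → R y z x
    transitive : ∀ {x y z u} → R x y z → R y u z → R x u z
    compatible : ∀ {x y z} u v → R x y z → R ((u ∙ x) ∙ v) ((u ∙ y) ∙ v) ((u ∙ z) ∙ v)

-- First-order logic (general signatures), classical satisfaction via the
-- Gödel–Gentzen negative translation.

record Signature : Set₁ where
  field
    Fun    : Set
    fArity : Fun → ℕ
    Rel    : Set
    rArity : Rel → ℕ

record Structure (L : Signature) : Set₁ where
  open Signature L
  field
    Carrier : Set
    fun     : (f : Fun) → (Fin (fArity f) → Carrier) → Carrier
    rel     : (r : Rel) → (Fin (rArity r) → Carrier) → Set

module _ (L : Signature) where
  open Signature L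

  data Term (n : ℕ) : Set where
    var : Fin n → Term n
    app : (f : Fun) → (Fin (fArity f) → Term n) → Term n

  data Formula : ℕ → Set where
    _≐_  : ∀ {n} → Term n → Term n → Formula n
    atom : ∀ {n} (r : Rel) → (Fin (rArity r) → Term n) → Formula n
    ¬'_  : ∀ {n} → Formula n → Formula n
    _∧'_ : ∀ {n} → Formula n → Formula n → Formula n
    ∀'_  : ∀ {n} → Formula (suc n) → Formula n

  Sentence : Set
  Sentence = Formula zero

module _ {L : Signature} (S : Structure L) where
  open Signature L
  open Structure S

  extend : ∀ {n} → Carrier → (Fin n → Carrier) → Fin (suc n) → Carrier
  extend a ρ zero    = a
  extend a ρ (suc i) = ρ i

  eval : ∀ {n} → (Fin n → Carrier) → Term L n → Carrier
  eval ρ (var i)    = ρ i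
  eval ρ (app f ts) = fun f (λ i → eval ρ (ts i))

  Sat : ∀ {n} → Formula L n → (Fin n → Carrier) → Set
  Sat (t ≐ u)    ρ = ¬ ¬ (eval ρ t ≡ eval ρ u)
  Sat (atom r ts) ρ = ¬ ¬ rel r (λ i → eval ρ (ts i))
  Sat (¬' φ)     ρ = ¬ Sat φ ρ
  Sat (φ ∧' ψ)   ρ = Sat φ ρ × Sat ψ ρ
  Sat (∀' φ)     ρ = ∀ a → Sat φ (extend a ρ)

noVars : {A : Set} → Fin zero → A
noVars ()

_≡ₑ_ : {L : Signature} → Structure L → Structure L → Set
_≡ₑ_ {L} S T = (φ : Sentence L) → Sat S φ noVars ⇔ Sat T φ noVars

ElementaryAlong : {L : Signature} (S T : Structure L) →
                  (Structure.Carrier S → Structure.Carrier T) → Set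
ElementaryAlong {L} S T ι =
  ∀ {n} (φ : Formula L n) (ρ : Fin n → Structure.Carrier S) →
  Sat S φ ρ ⇔ Sat T φ (λ i → ι (ρ i))

data FunC : Set where
  mulC unitC invC : FunC

data RelC : Set where
  RC : RelC

Lc : Signature
Lc = record
  { Fun = FunC
  ; fArity = λ { mulC → 2 ; unitC → 0 ; invC → 1 }
  ; Rel = RelC
  ; rArity = λ { RC → 3 }
  }

asLc : CyclicallyOrderedGroup → Structure Lc
asLc G = record
  { Carrier = Carrier
  ; fun = λ { mulC xs → xs zero ∙ xs (suc zero)
            ; unitC xs → e
            ; invC xs → (xs zero) ⁻¹ }
  ; rel = λ { RC xs → R (xs zero) (xs (suc zero)) (xs (suc (suc zero))) }
  }
  where open CyclicallyOrderedGroup G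

module Unwound (G : CyclicallyOrderedGroup) where
  open CyclicallyOrderedGroup G

  UW : Set
  UW = ℤ × Carrier

  _≤uw_ : UW → UW → Set
  (m , g) ≤uw (m' , g') =
    ((m , g) ≡ (m' , g')) ⊎ (m < m') ⊎ ((m ≡ m') × (R e g g' ⊎ g ≡ e))

  -- graph of the group law: MulUW x y z  iff  x · y = z in uw(G)
  MulUW : UW → UW → UW → Set
  MulUW (k , g) (m , h) (n , c) =
      (g ≡ e × n ≡ k + m × c ≡ h)
    ⊎ (h ≡ e × n ≡ k + m × c ≡ g)
    ⊎ (g ≢ e × h ≢ e × R e g (g ∙ h) × n ≡ k + m × c ≡ g ∙ h)
    ⊎ (g ≢ e × h ≢ e × R e (g ∙ h) g × n ≡ (k + m) + 1ℤ × c ≡ g ∙ h)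
    ⊎ (g ≢ e × h ≢ e × g ∙ h ≡ e × n ≡ (k + m) + 1ℤ × c ≡ e)

  -- membership in the subgroup ⟨z_G⟩ = {(m,e) | m ∈ ℤ}, z_G = (1,e)
  InZ : UW → Set
  InZ (m , g) = g ≡ e

data RelM : Set where
  mulM leM MM : RelM

LM : Signature
LM = record
  { Fun = ⊥
  ; fArity = λ ()
  ; Rel = RelM
  ; rArity = λ { mulM → 3 ; leM → 2 ; MM → 1 }
  }

uwStructure : CyclicallyOrderedGroup → Structure LM
uwStructure G = record
  { Carrier = UW
  ; fun = λ ()
  ; rel = λ { mulM xs → MulUW (xs zero) (xs (suc zero)) (xs (suc (suc zero)))
            ; leM xs → xs zero ≤uw xs (suc zero)
            ; MM xs → InZ (xs zero) }
  }
  where open Unwound G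

record IsSubstructure (G G' : CyclicallyOrderedGroup) 
         (ι : CyclicallyOrderedGroup.Carrier G → CyclicallyOrderedGroup.Carrier G') : Set where
  private
    module A = CyclicallyOrderedGroup G
    module B = CyclicallyOrderedGroup G'
  field
    injective : ∀ {x y} → ι x ≡ ι y → x ≡ y
    pres-∙    : ∀ x y → ι (x A.∙ y) ≡ ι x B.∙ ι y
    pres-e    : ι A.e ≡ B.e
    pres-⁻¹   : ∀ x → ι (x A.⁻¹) ≡ (ι x) B.⁻¹
    pres-R    : ∀ x y z → A.R x y z ⇔ B.R (ι x) (ι y) (ι z)

uwMap : {G G' : CyclicallyOrderedGroup} →
        (CyclicallyOrderedGroup.Carrier G → CyclicallyOrderedGroup.Carrier G') →
        Unwound.UW G → Unwound.UW G'
uwMap ι (m , g) = (m , ι g)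

{-# OPTIONS --safe #-}
module Submission where

-- (G, R) is interpretable in uw(G): G is the quotient of uw(G) by M = ⟨z_G⟩, and
-- R(x, y, z) holds iff R(e, x⁻¹y, x⁻¹z), which holds iff x⁻¹y and x⁻¹z have lifts
-- p < q with no element of M in [p, q].  Translating L_c-formulas accordingly, the
-- theory of uw(G) (with parameters) determines that of G.
--
-- Conversely, the product, order and M of uw(G) = ℤ × G are computed from the levels
-- (integer parts) and finitely many L_c-facts about the G-parts: whether g = e, whether
-- R(e, g, h), whether the product g h carries over to the next turn.  By induction, every
-- L_M-formula φ(x̄) is equivalent, uniformly in G, to a condition on the levels of x̄ and
-- on the truth values of finitely many L_c-formulas at the G-parts of x̄; a quantifier
-- over ℤ × G becomes one over ℤ and one over the finitely many truth valuations
-- realised in G.  So the theory of G determines that of uw(G).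
--
-- Satisfaction is the negative translation, so every Sat is ¬¬-stable and excluded
-- middle may be used freely under ¬¬.

open import Defs
open import Level using (0ℓ)
open import Data.Bool using (Bool; true; false; T)
open import Data.Empty using (⊥-elim)
import Data.Fin as Fin
open import Data.Fin using (Fin; zero; suc; _↑ˡ_; _↑ʳ_; finToFun; funToFin)
open import Data.Fin.Properties using (2↔Bool; finToFun-funToFin)
open import Data.Fin.Patterns using (0F; 1F; 2F)
open import Data.Integer as ℤ using (ℤ; 0ℤ; 1ℤ; _+_; -_; _<_; _≤_; _≟_)
  renaming (suc to sucℤ)
import Data.Integer.Properties as ℤ
open import Data.Nat using (ℕ; zero; suc; _^_) renaming (_+_ to _+ℕ_)
open import Data.Product using (Σ; _×_; _,_; proj₁; proj₂)
open import Data.Sum using (_⊎_; inj₁; inj₂)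
open import Data.Unit using (tt)
open import Data.Vec.Functional using ([]; _∷_; _++_)
open import Data.Vec.Functional.Properties using (lookup-++ˡ; lookup-++ʳ)
open import Effect.Monad using (RawMonad)
open import Function using (_∘_; const)
open import Function.Bundles using (_⇔_; mk⇔; Equivalence; Inverse)
open import Function.Related.TypeIsomorphisms using (¬-cong-⇔)
open import Data.Product.Function.NonDependent.Propositional using (_×-⇔_)
open import Function.Properties.Equivalence using (⇔-setoid)
  renaming (trans to ⇔-trans; sym to ⇔-sym)
open import Relation.Binary.PropositionalEquality
  using (_≡_; _≢_; _≗_; refl; sym; trans; cong; cong₂; subst; subst₂)
open import Relation.Nullary using (¬_; Dec; yes; no; does)
open import Relation.Nullary.Decidable using (¬¬-excluded-middle; decidable-stable; T?)
open import Relation.Nullary.Negation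
  using (Stable; ¬¬-Monad; ¬¬-map; negated-stable; contradiction; ¬∃⟶∀¬; ∀¬⟶¬∃; ∃⟶¬∀¬)
import Algebra.Properties.Group as GroupProperties
import Algebra.Bundles as Bundles
import Relation.Binary.Reasoning.Setoid

open Equivalence using (to; from)
module ⇔-Reasoning = Relation.Binary.Reasoning.Setoid (⇔-setoid 0ℓ)
open RawMonad (¬¬-Monad {0ℓ}) using (pure; _>>=_)
open GroupProperties (Bundles.AbelianGroup.group ℤ.+-0-abelianGroup)
  using () renaming (\\-leftDividesˡ to i+[-i+j]≡j)

¬¬-⇔ : {A B : Set} → Stable A → Stable B → ¬ ¬ (A ⇔ B) → A ⇔ B
¬¬-⇔ sa sb ¬¬A⇔B = mk⇔ (λ a → sb (¬¬-map (λ A⇔B → to A⇔B a) ¬¬A⇔B))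
                       (λ b → sa (¬¬-map (λ A⇔B → from A⇔B b) ¬¬A⇔B))

¬¬-case : {A B : Set} → (A → ¬ ¬ B) → (¬ A → ¬ ¬ B) → ¬ ¬ B
¬¬-case f g = ¬¬-excluded-middle >>= λ { (yes a) → f a ; (no ¬a) → g ¬a }

¬∀¬⇒¬¬∃ : {A : Set} {P : A → Set} → ¬ (∀ a → ¬ P a) → ¬ ¬ Σ A P
¬∀¬⇒¬¬∃ ¬∀¬ = ¬∀¬ ∘ ¬∃⟶∀¬

¬¬∃⇒¬∀¬ : {A : Set} {P : A → Set} → ¬ ¬ Σ A P → ¬ (∀ a → ¬ P a)
¬¬∃⇒¬∀¬ ¬¬∃ = ¬¬∃ ∘ ∀¬⟶¬∃

¬¬¬⇔¬ : {A : Set} → (¬ ¬ ¬ A) ⇔ (¬ A)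
¬¬¬⇔¬ = mk⇔ negated-stable (λ ¬a ¬¬a → ¬¬a ¬a)

¬¬-cong : {A B : Set} → (A → ¬ ¬ B) → (B → ¬ ¬ A) → (¬ ¬ A) ⇔ (¬ ¬ B)
¬¬-cong f g = mk⇔ (_>>= f) (_>>= g)

subst₃ : {A : Set} (P : A → A → A → Set) {x x' y y' z z' : A} →
         x ≡ x' → y ≡ y' → z ≡ z' → P x y z → P x' y' z'
subst₃ P refl refl refl p = p

TruthValue : Bool → Set → Set
TruthValue b P = T b ⇔ P

IsValuation : ∀ {k} → (Fin k → Set) → (Fin k → Bool) → Set
IsValuation P v = ∀ j → TruthValue (v j) (P j)

TruthValue-does : {P : Set} (d : Dec P) → TruthValue (does d) P
TruthValue-does (yes p) = mk⇔ (const p) (const tt)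
TruthValue-does (no ¬p) = mk⇔ (λ ()) ¬p

¬¬-valuation : ∀ {k} (P : Fin k → Set) → ¬ ¬ Σ (Fin k → Bool) (IsValuation P)
¬¬-valuation {zero} P = pure ([] , λ ())
¬¬-valuation {suc k} P = do
  (v , val) ← ¬¬-valuation (P ∘ suc)
  d ← ¬¬-excluded-middle
  pure (does d ∷ v , λ { zero → TruthValue-does d ; (suc j) → val j })

∃' : ∀ {L n} → Formula L (suc n) → Formula L n
∃' φ = ¬' ∀' ¬' φ

⊤' : ∀ {L n} → Formula L n
⊤' = ∀' (var zero ≐ var zero)

⋀' : ∀ {L n k} → (Fin k → Formula L n) → Formula L n
⋀' {k = zero} φs = ⊤'
⋀' {k = suc k} φs = φs zero ∧' ⋀' (φs ∘ suc)

literal : ∀ {L n} → Bool → Formula L n → Formula L n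
literal true  φ = φ
literal false φ = ¬' φ

record Extensional {L : Signature} (S : Structure L) : Set₁ where
  open Signature L
  open Structure S
  field
    fun-cong : ∀ f {xs ys : Fin (fArity f) → Carrier} → xs ≗ ys → fun f xs ≡ fun f ys
    rel-cong : ∀ r {xs ys : Fin (rArity r) → Carrier} → xs ≗ ys → rel r xs → rel r ys

module _ {L : Signature} (S : Structure L) where
  open Structure S

  Sat-stable : ∀ {n} (φ : Formula L n) ρ → Stable (Sat S φ ρ)
  Sat-stable (t ≐ u)     ρ = negated-stable
  Sat-stable (atom r ts) ρ = negated-stable
  Sat-stable (¬' φ)      ρ = negated-stable
  Sat-stable (φ ∧' ψ)    ρ ¬¬s =
    Sat-stable φ ρ (¬¬-map proj₁ ¬¬s) , Sat-stable ψ ρ (¬¬-map proj₂ ¬¬s)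
  Sat-stable (∀' φ)      ρ ¬¬s a = Sat-stable φ (extend S a ρ) (¬¬-map (λ s → s a) ¬¬s)

  Sat-⋀' : ∀ {n k} (φs : Fin k → Formula L n) ρ → Sat S (⋀' φs) ρ ⇔ (∀ j → Sat S (φs j) ρ)
  Sat-⋀' {k = zero}  φs ρ = mk⇔ (λ _ ()) (λ _ a ¬a≡a → ¬a≡a refl)
  Sat-⋀' {k = suc k} φs ρ = mk⇔
    (λ { (s₀ , s) zero → s₀ ; (s₀ , s) (suc j) → to (Sat-⋀' (φs ∘ suc) ρ) s j })
    (λ s → s zero , from (Sat-⋀' (φs ∘ suc) ρ) (s ∘ suc))

  Sat-literal : ∀ {n} b (φ : Formula L n) ρ → Sat S (literal b φ) ρ ⇔ TruthValue b (Sat S φ ρ)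
  Sat-literal true  φ ρ = mk⇔ (λ s → mk⇔ (const s) (const tt)) (λ tv → to tv tt)
  Sat-literal false φ ρ = mk⇔ (λ ¬s → mk⇔ (λ ()) ¬s) (λ tv → from tv)

  module _ (ext : Extensional S) where
    open Extensional ext

    eval-cong : ∀ {n} {ρ ρ' : Fin n → Carrier} → ρ ≗ ρ' → ∀ t → eval S ρ t ≡ eval S ρ' t
    eval-cong ρ≗ρ' (var i)    = ρ≗ρ' i
    eval-cong ρ≗ρ' (app f ts) = fun-cong f (eval-cong ρ≗ρ' ∘ ts)

    extend-cong : ∀ {n} {ρ ρ' : Fin n → Carrier} a → ρ ≗ ρ' → extend S a ρ ≗ extend S a ρ'
    extend-cong a ρ≗ρ' zero    = refl
    extend-cong a ρ≗ρ' (suc i) = ρ≗ρ' i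

    Sat-cong : ∀ {n} (φ : Formula L n) {ρ ρ' : Fin n → Carrier} →
               ρ ≗ ρ' → Sat S φ ρ → Sat S φ ρ'
    Sat-cong (t ≐ u) ρ≗ρ' =
      ¬¬-map (λ eq → trans (sym (eval-cong ρ≗ρ' t)) (trans eq (eval-cong ρ≗ρ' u)))
    Sat-cong (atom r ts) ρ≗ρ' = ¬¬-map (rel-cong r (eval-cong ρ≗ρ' ∘ ts))
    Sat-cong (¬' φ) ρ≗ρ' ¬s s = ¬s (Sat-cong φ (sym ∘ ρ≗ρ') s)
    Sat-cong (φ ∧' ψ) ρ≗ρ' (sφ , sψ) = Sat-cong φ ρ≗ρ' sφ , Sat-cong ψ ρ≗ρ' sψ
    Sat-cong (∀' φ) ρ≗ρ' s a = Sat-cong φ (extend-cong a ρ≗ρ') (s a)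

    Sat-cong-⇔ : ∀ {n} (φ : Formula L n) {ρ ρ' : Fin n → Carrier} →
                 ρ ≗ ρ' → Sat S φ ρ ⇔ Sat S φ ρ'
    Sat-cong-⇔ φ ρ≗ρ' = mk⇔ (Sat-cong φ ρ≗ρ') (Sat-cong φ (sym ∘ ρ≗ρ'))

    Sat-sentence : (φ : Sentence L) (ρ : Fin 0 → Carrier) → Sat S φ ρ ⇔ Sat S φ noVars
    Sat-sentence φ ρ = Sat-cong-⇔ φ (λ ())

groupOf : CyclicallyOrderedGroup → Bundles.Group 0ℓ 0ℓ
groupOf G = record { isGroup = CyclicallyOrderedGroup.isGroup G }

module CyclicOrderProperties (G : CyclicallyOrderedGroup) where
  open CyclicallyOrderedGroup G
  open Bundles.Group (groupOf G) public using (identityˡ; identityʳ; inverseˡ; inverseʳ)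
  open GroupProperties (groupOf G) public
    using (identityʳ-unique; inverseʳ-unique; \\-leftDividesˡ)

  R-asym : ∀ {x y z} → R x y z → ¬ R x z y
  R-asym r r' = proj₁ (strict (transitive r (cyclic (cyclic r')))) refl

  R-translate : ∀ u {x y z} → R x y z → R (u ∙ x) (u ∙ y) (u ∙ z)
  R-translate u r = subst₃ R (identityʳ _) (identityʳ _) (identityʳ _) (compatible u e r)

  R-translate-to-e : ∀ {x y z} → R x y z → R e ((x ⁻¹) ∙ y) ((x ⁻¹) ∙ z)
  R-translate-to-e {x} r = subst₃ R (inverseˡ x) refl refl (R-translate (x ⁻¹) r)

  asLc-extensional : Extensional (asLc G)
  asLc-extensional = record { fun-cong = fun-cong ; rel-cong = rel-cong }
    where
    fun-cong : ∀ f {xs ys} → xs ≗ ys → Structure.fun (asLc G) f xs ≡ Structure.fun (asLc G) f ys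
    fun-cong mulC  eq = cong₂ _∙_ (eq 0F) (eq 1F)
    fun-cong unitC eq = refl
    fun-cong invC  eq = cong _⁻¹ (eq 0F)
    rel-cong : ∀ r {xs ys} → xs ≗ ys → Structure.rel (asLc G) r xs → Structure.rel (asLc G) r ys
    rel-cong RC eq = subst₃ R (eq 0F) (eq 1F) (eq 2F)

data AddWithCarry (C : Set) (k m : ℤ) : ℤ → Set where
  carry   : C → AddWithCarry C k m (k + m + 1ℤ)
  noCarry : ¬ C → AddWithCarry C k m (k + m)

AddWithCarry-cong : ∀ {C D k m n} → C ⇔ D → AddWithCarry C k m n → AddWithCarry D k m n
AddWithCarry-cong C⇔D (carry c)    = carry (to C⇔D c)
AddWithCarry-cong C⇔D (noCarry ¬c) = noCarry (¬c ∘ from C⇔D)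

module UnwoundProperties (G : CyclicallyOrderedGroup) where
  open CyclicallyOrderedGroup G
  open Unwound G
  open CyclicOrderProperties G

  Carry : Carrier → Carrier → Set
  Carry g h = g ≢ e × h ≢ e × ¬ R e g (g ∙ h)

  UnwoundProduct : UW → UW → UW → Set
  UnwoundProduct (k , g) (m , h) (n , c) = c ≡ g ∙ h × AddWithCarry (Carry g h) k m n

  MulUW-sound : ∀ x y z → MulUW x y z → UnwoundProduct x y z
  MulUW-sound (k , g) (m , h) (n , c) (inj₁ (g≡e , refl , c≡h)) =
    trans c≡h (sym (trans (cong (_∙ h) g≡e) (identityˡ h))) , noCarry (λ (g≢e , _) → g≢e g≡e)
  MulUW-sound (k , g) (m , h) (n , c) (inj₂ (inj₁ (h≡e , refl , c≡g))) =
    trans c≡g (sym (trans (cong (g ∙_) h≡e) (identityʳ g))) , noCarry (λ (_ , h≢e , _) → h≢e h≡e)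
  MulUW-sound _ _ _ (inj₂ (inj₂ (inj₁ (_ , _ , r , refl , c≡)))) =
    c≡ , noCarry (λ (_ , _ , ¬r) → ¬r r)
  MulUW-sound _ _ _ (inj₂ (inj₂ (inj₂ (inj₁ (g≢e , h≢e , r , refl , c≡))))) =
    c≡ , carry (g≢e , h≢e , R-asym r)
  MulUW-sound _ _ _ (inj₂ (inj₂ (inj₂ (inj₂ (g≢e , h≢e , gh≡e , refl , c≡e))))) =
    trans c≡e (sym gh≡e) , carry (g≢e , h≢e , λ r → proj₂ (proj₂ (strict r)) (sym gh≡e))

  MulUW-complete : ∀ x y z → UnwoundProduct x y z → ¬ ¬ MulUW x y z
  MulUW-complete (k , g) (m , h) (n , c) (c≡ , carry (g≢e , h≢e , ¬r)) = ¬¬-case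
    (λ gh≡e → pure (inj₂ (inj₂ (inj₂ (inj₂ (g≢e , h≢e , gh≡e , refl , trans c≡ gh≡e))))))
    (λ gh≢e → case (total (g≢e ∘ sym) (h≢e ∘ identityʳ-unique g h ∘ sym) (gh≢e ∘ sym)))
    where
    case : R e g (g ∙ h) ⊎ R e (g ∙ h) g → ¬ ¬ MulUW (k , g) (m , h) (n , c)
    case (inj₁ r) = contradiction r ¬r
    case (inj₂ r) = pure (inj₂ (inj₂ (inj₂ (inj₁ (g≢e , h≢e , r , refl , c≡)))))
  MulUW-complete (k , g) (m , h) (n , c) (c≡ , noCarry ¬carry) = ¬¬-case
    (λ g≡e → pure (inj₁ (g≡e , refl , trans c≡ (trans (cong (_∙ h) g≡e) (identityˡ h)))))
    λ g≢e → ¬¬-case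
      (λ h≡e → pure (inj₂ (inj₁ (h≡e , refl , trans c≡ (trans (cong (g ∙_) h≡e) (identityʳ g))))))
      λ h≢e → do
        r ← λ ¬r → ¬carry (g≢e , h≢e , ¬r)
        pure (inj₂ (inj₂ (inj₁ (g≢e , h≢e , r , refl , c≡))))

  ≤uw-level : ∀ {k g m h} → (k , g) ≤uw (m , h) → k ≤ m
  ≤uw-level (inj₁ eq)                  = ℤ.≤-reflexive (cong proj₁ eq)
  ≤uw-level (inj₂ (inj₁ k<m))          = ℤ.<⇒≤ k<m
  ≤uw-level (inj₂ (inj₂ (k≡m , _)))    = ℤ.≤-reflexive k≡m

  ≤uw-M-level : ∀ {k g j c} → g ≢ e → c ≡ e → (k , g) ≤uw (j , c) → k < j
  ≤uw-M-level g≢e c≡e (inj₁ eq)                     = ⊥-elim (g≢e (trans (cong proj₂ eq) c≡e))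
  ≤uw-M-level g≢e c≡e (inj₂ (inj₁ k<j))             = k<j
  ≤uw-M-level g≢e c≡e (inj₂ (inj₂ (_ , inj₁ r)))    = ⊥-elim (proj₂ (proj₂ (strict r)) (sym c≡e))
  ≤uw-M-level g≢e c≡e (inj₂ (inj₂ (_ , inj₂ g≡e)))  = ⊥-elim (g≢e g≡e)

  ≤uw-next-turn : ∀ {k g} → (k , g) ≤uw (sucℤ k , e)
  ≤uw-next-turn = inj₂ (inj₁ (ℤ.suc[i]≤j⇒i<j ℤ.≤-refl))

  next-turn-≤uw : ∀ {k m h} → k < m → (sucℤ k , e) ≤uw (m , h)
  next-turn-≤uw {k} {m} k<m with sucℤ k ≟ m
  ... | yes 1+k≡m = inj₂ (inj₂ (1+k≡m , inj₂ refl))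
  ... | no  1+k≢m = inj₂ (inj₁ (ℤ.≤∧≢⇒< (ℤ.i<j⇒suc[i]≤j k<m) 1+k≢m))

  ¬¬-MulUW-exists : ∀ x y → ¬ ¬ Σ UW (MulUW x y)
  ¬¬-MulUW-exists (k , g) (m , h) = ¬¬-case
    (λ c → ¬¬-map (_ ,_) (MulUW-complete (k , g) (m , h) (k + m + 1ℤ , g ∙ h) (refl , carry c)))
    (λ ¬c → ¬¬-map (_ ,_) (MulUW-complete (k , g) (m , h) (k + m , g ∙ h) (refl , noCarry ¬c)))

  uw-extensional : Extensional (uwStructure G)
  uw-extensional = record { fun-cong = λ () ; rel-cong = rel-cong }
    where
    rel-cong : ∀ r {xs ys} → xs ≗ ys →
               Structure.rel (uwStructure G) r xs → Structure.rel (uwStructure G) r ys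
    rel-cong mulM eq = subst₃ MulUW (eq 0F) (eq 1F) (eq 2F)
    rel-cong leM  eq = subst₂ _≤uw_ (eq 0F) (eq 1F)
    rel-cong MM   eq = subst InZ (eq 0F)

-- Interpreting (G, R) in uw(G)

Mul' : ∀ {n} → Fin n → Fin n → Fin n → Formula LM n
Mul' x y z = atom mulM (var x ∷ var y ∷ var z ∷ [])

Le' : ∀ {n} → Fin n → Fin n → Formula LM n
Le' x y = atom leM (var x ∷ var y ∷ [])

M' : ∀ {n} → Fin n → Formula LM n
M' x = atom MM (var x ∷ [])

SameClass : ∀ {n} → Fin n → Fin n → Formula LM n
SameClass x y = ∃' (Mul' (suc x) zero (suc y) ∧' M' zero)

ProductClass : ∀ {n} → Fin n → Fin n → Fin n → Formula LM n
ProductClass x y z = ∃' (Mul' (suc x) (suc y) zero ∧' SameClass zero (suc z))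

InverseClass : ∀ {n} → Fin n → Fin n → Formula LM n
InverseClass x y = ∃' (Mul' (suc x) (suc y) zero ∧' M' zero)

SameTurnBelow : ∀ {n} → Fin n → Fin n → Formula LM n
SameTurnBelow p q =
  (¬' M' p) ∧' ((Le' p q ∧' (¬' (var p ≐ var q))) ∧'
                (∀' (¬' (M' zero ∧' (Le' (suc p) zero ∧' Le' zero (suc q))))))

CyclicClass : ∀ {n} → Fin n → Fin n → Fin n → Formula LM n
CyclicClass x y z =
  ∃' (∃' (ProductClass (suc (suc x)) 1F (suc (suc y)) ∧'
          (ProductClass (suc (suc x)) 0F (suc (suc z)) ∧' SameTurnBelow 1F 0F)))

TermClass : ∀ {m n} → Term Lc m → (Fin m → Fin n) → Fin n → Formula LM n
TermClass (var i)        σ y = SameClass (σ i) y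
TermClass (app unitC ts) σ y = M' y
TermClass (app invC ts)  σ y = ∃' (TermClass (ts 0F) (Fin.suc ∘ σ) 0F ∧' InverseClass 0F (suc y))
TermClass (app mulC ts)  σ y =
  ∃' (∃' (TermClass (ts 0F) (Fin.suc ∘ Fin.suc ∘ σ) 1F ∧'
          (TermClass (ts 1F) (Fin.suc ∘ Fin.suc ∘ σ) 0F ∧' ProductClass 1F 0F (suc (suc y)))))

translate : ∀ {n} → Formula Lc n → Formula LM n
translate (t ≐ u)      = ∃' (TermClass t Fin.suc 0F ∧' TermClass u Fin.suc 0F)
translate (atom RC ts) =
  ∃' (∃' (∃' (TermClass (ts 0F) σ 2F ∧' (TermClass (ts 1F) σ 1F ∧'
              (TermClass (ts 2F) σ 0F ∧' CyclicClass 2F 1F 0F)))))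
  where σ = Fin.suc ∘ Fin.suc ∘ Fin.suc
translate (¬' φ)       = ¬' translate φ
translate (φ ∧' ψ)     = translate φ ∧' translate ψ
translate (∀' φ)       = ∀' translate φ

module Interpretation (G : CyclicallyOrderedGroup) where
  open CyclicallyOrderedGroup G
  open Unwound G
  open CyclicOrderProperties G
  open UnwoundProperties G

  private
    uw = uwStructure G
    π : UW → Carrier
    π = proj₂

  Sat-SameClass : ∀ {n} (ρ : Fin n → UW) x y →
                  Sat uw (SameClass x y) ρ ⇔ (¬ ¬ (π (ρ x) ≡ π (ρ y)))
  Sat-SameClass ρ x y = mk⇔
    (λ s → do
      (w , ¬¬mul , ¬¬w∈M) ← ¬∀¬⇒¬¬∃ s
      mul ← ¬¬mul
      w∈M ← ¬¬w∈M
      let y≡xw = proj₁ (MulUW-sound (ρ x) w (ρ y) mul)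
      pure (sym (trans y≡xw (trans (cong (π (ρ x) ∙_) w∈M) (identityʳ _)))))
    (λ ¬¬eq → ¬¬∃⇒¬∀¬ do
      eq ← ¬¬eq
      pure ((- proj₁ (ρ x) + proj₁ (ρ y) , e) ,
            pure (inj₂ (inj₁ (refl , sym (i+[-i+j]≡j (proj₁ (ρ x)) (proj₁ (ρ y))) , sym eq))) ,
            pure refl))

  Sat-ProductClass : ∀ {n} (ρ : Fin n → UW) x y z →
                     Sat uw (ProductClass x y z) ρ ⇔ (¬ ¬ (π (ρ x) ∙ π (ρ y) ≡ π (ρ z)))
  Sat-ProductClass ρ x y z = mk⇔
    (λ s → do
      (u , ¬¬mul , same) ← ¬∀¬⇒¬¬∃ s
      mul ← ¬¬mul
      u~z ← to (Sat-SameClass (extend uw u ρ) zero (suc z)) same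
      pure (trans (sym (proj₁ (MulUW-sound (ρ x) (ρ y) u mul))) u~z))
    (λ ¬¬eq → ¬¬∃⇒¬∀¬ do
      eq ← ¬¬eq
      (u , mul) ← ¬¬-MulUW-exists (ρ x) (ρ y)
      let u~z = trans (proj₁ (MulUW-sound (ρ x) (ρ y) u mul)) eq
      pure (u , pure mul , from (Sat-SameClass (extend uw u ρ) zero (suc z)) (pure u~z)))

  Sat-InverseClass : ∀ {n} (ρ : Fin n → UW) x y →
                     Sat uw (InverseClass x y) ρ ⇔ (¬ ¬ (π (ρ x) ∙ π (ρ y) ≡ e))
  Sat-InverseClass ρ x y = mk⇔
    (λ s → do
      (u , ¬¬mul , ¬¬u∈M) ← ¬∀¬⇒¬¬∃ s
      mul ← ¬¬mul
      u∈M ← ¬¬u∈M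
      pure (trans (sym (proj₁ (MulUW-sound (ρ x) (ρ y) u mul))) u∈M))
    (λ ¬¬eq → ¬¬∃⇒¬∀¬ do
      eq ← ¬¬eq
      (u , mul) ← ¬¬-MulUW-exists (ρ x) (ρ y)
      pure (u , pure mul , pure (trans (proj₁ (MulUW-sound (ρ x) (ρ y) u mul)) eq)))

  SameTurnBelow-sound : ∀ {n} (ρ : Fin n → UW) p q →
                        Sat uw (SameTurnBelow p q) ρ → ¬ ¬ R e (π (ρ p)) (π (ρ q))
  SameTurnBelow-sound ρ p q (p∉M , (¬¬p≤q , p≢q) , noMBetween) = ¬¬p≤q >>= cases
    where
    cases : ρ p ≤uw ρ q → ¬ ¬ R e (π (ρ p)) (π (ρ q))
    cases (inj₁ p≡q)                  = contradiction (pure p≡q) p≢q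
    cases (inj₂ (inj₁ k<m))           = ⊥-elim (noMBetween (sucℤ (proj₁ (ρ p)) , e)
                                          (pure refl , pure ≤uw-next-turn , pure (next-turn-≤uw k<m)))
    cases (inj₂ (inj₂ (_ , inj₁ r)))  = pure r
    cases (inj₂ (inj₂ (_ , inj₂ g≡e))) = contradiction (pure g≡e) p∉M

  SameTurnBelow-complete : ∀ {n} (ρ : Fin n → UW) p q → R e (π (ρ p)) (π (ρ q)) →
                           proj₁ (ρ p) ≡ proj₁ (ρ q) → Sat uw (SameTurnBelow p q) ρ
  SameTurnBelow-complete ρ p q r k≡m =
    (λ ¬¬g≡e → ¬¬g≡e (e≢g ∘ sym)) ,
    (pure (inj₂ (inj₂ (k≡m , inj₁ r))) , (λ ¬¬p≡q → ¬¬p≡q (g≢h ∘ cong proj₂))) ,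
    λ (j , c) (¬¬c≡e , ¬¬p≤w , ¬¬w≤q) →
      ¬¬c≡e λ c≡e → ¬¬p≤w λ p≤w → ¬¬w≤q λ w≤q →
        ℤ.<⇒≱ (≤uw-M-level (e≢g ∘ sym) c≡e p≤w) (subst (j ≤_) (sym k≡m) (≤uw-level w≤q))
    where
    e≢g = proj₁ (strict r)
    g≢h = proj₁ (proj₂ (strict r))

  Sat-CyclicClass : ∀ {n} (ρ : Fin n → UW) x y z →
                    Sat uw (CyclicClass x y z) ρ ⇔ (¬ ¬ R (π (ρ x)) (π (ρ y)) (π (ρ z)))
  Sat-CyclicClass ρ x y z = mk⇔
    (λ s → do
      (p , s') ← ¬∀¬⇒¬¬∃ s
      (q , xp~y , xq~z , turn) ← ¬∀¬⇒¬¬∃ s'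
      let ρ₂ = extend uw q (extend uw p ρ)
      xp≡y ← to (Sat-ProductClass ρ₂ (suc (suc x)) 1F (suc (suc y))) xp~y
      xq≡z ← to (Sat-ProductClass ρ₂ (suc (suc x)) 0F (suc (suc z))) xq~z
      r ← SameTurnBelow-sound ρ₂ 1F 0F turn
      pure (subst₃ R (identityʳ _) xp≡y xq≡z (R-translate (π (ρ x)) r)))
    (λ ¬¬r → ¬¬∃⇒¬∀¬ do
      r ← ¬¬r
      let p = (0ℤ , (π (ρ x) ⁻¹) ∙ π (ρ y))
          q = (0ℤ , (π (ρ x) ⁻¹) ∙ π (ρ z))
          ρ₂ = extend uw q (extend uw p ρ)
      pure (p , ∃⟶¬∀¬ (q ,
        from (Sat-ProductClass ρ₂ (suc (suc x)) 1F (suc (suc y))) (pure (\\-leftDividesˡ _ _)) ,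
        from (Sat-ProductClass ρ₂ (suc (suc x)) 0F (suc (suc z))) (pure (\\-leftDividesˡ _ _)) ,
        SameTurnBelow-complete ρ₂ 1F 0F (R-translate-to-e r) refl)))

  Sat-TermClass : ∀ {m n} (t : Term Lc m) (σ : Fin m → Fin n) (ρ : Fin n → UW) y →
                  Sat uw (TermClass t σ y) ρ ⇔ (¬ ¬ (eval (asLc G) (π ∘ ρ ∘ σ) t ≡ π (ρ y)))
  Sat-TermClass (var i)        σ ρ y = Sat-SameClass ρ (σ i) y
  Sat-TermClass (app unitC ts) σ ρ y = mk⇔ (¬¬-map sym) (¬¬-map sym)
  Sat-TermClass (app invC ts)  σ ρ y = mk⇔
    (λ s → do
      (u , t~u , uy~e) ← ¬∀¬⇒¬¬∃ s
      t≡u ← to (Sat-TermClass (ts 0F) _ (extend uw u ρ) 0F) t~u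
      uy≡e ← to (Sat-InverseClass (extend uw u ρ) 0F (suc y)) uy~e
      pure (trans (cong _⁻¹ t≡u) (sym (inverseʳ-unique _ _ uy≡e))))
    (λ ¬¬eq → ¬¬∃⇒¬∀¬ do
      eq ← ¬¬eq
      let t = eval (asLc G) (π ∘ ρ ∘ σ) (ts 0F)
          u = (0ℤ , t)
      pure (u ,
        from (Sat-TermClass (ts 0F) _ (extend uw u ρ) 0F) (pure refl) ,
        from (Sat-InverseClass (extend uw u ρ) 0F (suc y))
          (pure (trans (cong (t ∙_) (sym eq)) (inverseʳ t)))))
  Sat-TermClass (app mulC ts)  σ ρ y = mk⇔
    (λ s → do
      (u , s') ← ¬∀¬⇒¬¬∃ s
      (v , t₁~u , t₂~v , uv~y) ← ¬∀¬⇒¬¬∃ s'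
      let ρ₂ = extend uw v (extend uw u ρ)
      t₁≡u ← to (Sat-TermClass (ts 0F) _ ρ₂ 1F) t₁~u
      t₂≡v ← to (Sat-TermClass (ts 1F) _ ρ₂ 0F) t₂~v
      uv≡y ← to (Sat-ProductClass ρ₂ 1F 0F (suc (suc y))) uv~y
      pure (trans (cong₂ _∙_ t₁≡u t₂≡v) uv≡y))
    (λ ¬¬eq → ¬¬∃⇒¬∀¬ do
      eq ← ¬¬eq
      let u = (0ℤ , eval (asLc G) (π ∘ ρ ∘ σ) (ts 0F))
          v = (0ℤ , eval (asLc G) (π ∘ ρ ∘ σ) (ts 1F))
          ρ₂ = extend uw v (extend uw u ρ)
      pure (u , ∃⟶¬∀¬ (v ,
        from (Sat-TermClass (ts 0F) _ ρ₂ 1F) (pure refl) ,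
        from (Sat-TermClass (ts 1F) _ ρ₂ 0F) (pure refl) ,
        from (Sat-ProductClass ρ₂ 1F 0F (suc (suc y))) (pure eq))))

  Sat-translate : ∀ {n} (φ : Formula Lc n) (ρ : Fin n → UW) →
                  Sat (asLc G) φ (π ∘ ρ) ⇔ Sat uw (translate φ) ρ
  Sat-translate (t ≐ u) ρ = mk⇔
    (λ ¬¬eq → ¬¬∃⇒¬∀¬ do
      eq ← ¬¬eq
      let w = (0ℤ , eval (asLc G) (π ∘ ρ) u)
      pure (w , from (Sat-TermClass t _ (extend uw w ρ) 0F) (pure eq) ,
                from (Sat-TermClass u _ (extend uw w ρ) 0F) (pure refl)))
    (λ s → do
      (w , t~w , u~w) ← ¬∀¬⇒¬¬∃ s
      t≡w ← to (Sat-TermClass t _ (extend uw w ρ) 0F) t~w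
      u≡w ← to (Sat-TermClass u _ (extend uw w ρ) 0F) u~w
      pure (trans t≡w (sym u≡w)))
  Sat-translate (atom RC ts) ρ = mk⇔
    (λ ¬¬r → ¬¬∃⇒¬∀¬ do
      r ← ¬¬r
      let value : Fin 3 → UW
          value i = (0ℤ , eval (asLc G) (π ∘ ρ) (ts i))
          ρ₃ = extend uw (value 2F) (extend uw (value 1F) (extend uw (value 0F) ρ))
      pure (value 0F , ∃⟶¬∀¬ (value 1F , ∃⟶¬∀¬ (value 2F ,
        from (Sat-TermClass (ts 0F) _ ρ₃ 2F) (pure refl) ,
        from (Sat-TermClass (ts 1F) _ ρ₃ 1F) (pure refl) ,
        from (Sat-TermClass (ts 2F) _ ρ₃ 0F) (pure refl) ,
        from (Sat-CyclicClass ρ₃ 2F 1F 0F) (pure r)))))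
    (λ s → do
      (a , s') ← ¬∀¬⇒¬¬∃ s
      (b , s'') ← ¬∀¬⇒¬¬∃ s'
      (c , t₀~a , t₁~b , t₂~c , abc) ← ¬∀¬⇒¬¬∃ s''
      let ρ₃ = extend uw c (extend uw b (extend uw a ρ))
      t₀≡a ← to (Sat-TermClass (ts 0F) _ ρ₃ 2F) t₀~a
      t₁≡b ← to (Sat-TermClass (ts 1F) _ ρ₃ 1F) t₁~b
      t₂≡c ← to (Sat-TermClass (ts 2F) _ ρ₃ 0F) t₂~c
      r ← to (Sat-CyclicClass ρ₃ 2F 1F 0F) abc
      pure (subst₃ R (sym t₀≡a) (sym t₁≡b) (sym t₂≡c) r))
  Sat-translate (¬' φ)   ρ = ¬-cong-⇔ (Sat-translate φ ρ)
  Sat-translate (φ ∧' ψ) ρ = Sat-translate φ ρ ×-⇔ Sat-translate ψ ρ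
  Sat-translate (∀' φ)   ρ = mk⇔
    (λ s a → to (Sat-translate φ (extend uw a ρ))
                (Sat-cong (asLc G) asLc-extensional φ (π-extend a) (s (π a))))
    (λ s g → Sat-cong (asLc G) asLc-extensional φ (sym ∘ π-extend (0ℤ , g))
               (from (Sat-translate φ (extend uw (0ℤ , g) ρ)) (s (0ℤ , g))))
    where
    π-extend : ∀ a → extend (asLc G) (π a) (π ∘ ρ) ≗ π ∘ extend uw a ρ
    π-extend a zero    = refl
    π-extend a (suc i) = refl

-- Reducing L_M-formulas over uw(G) to L_c-formulas over G

e' : ∀ {n} → Term Lc n
e' = app unitC []

_·'_ : ∀ {n} → Term Lc n → Term Lc n → Term Lc n
a ·' b = app mulC (a ∷ b ∷ [])

R' : ∀ {n} → Term Lc n → Term Lc n → Term Lc n → Formula Lc n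
R' a b c = atom RC (a ∷ b ∷ c ∷ [])

CarryFormula : ∀ {n} → Fin n → Fin n → Formula Lc n
CarryFormula x y = (¬' (var x ≐ e')) ∧' ((¬' (var y ≐ e')) ∧' (¬' R' e' (var x) (var x ·' var y)))

module _ (G : CyclicallyOrderedGroup) where
  open CyclicallyOrderedGroup G
  open UnwoundProperties G

  Sat-CarryFormula : ∀ {n} (gs : Fin n → Carrier) x y →
                     Sat (asLc G) (CarryFormula x y) gs ⇔ Carry (gs x) (gs y)
  Sat-CarryFormula gs x y = ¬¬¬⇔¬ ×-⇔ (¬¬¬⇔¬ ×-⇔ ¬¬¬⇔¬)

-- A decomposition of φ in the style of Feferman–Vaught, uniform in G.
record Reduction {n} (φ : Formula LM n) : Set₁ where
  field
    size     : ℕ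
    β        : Fin size → Formula Lc n
    Φ        : (Fin n → ℤ) → (Fin size → Bool) → Set
    Φ-stable : ∀ ms v → Stable (Φ ms v)
    Φ-cong   : ∀ {ms ms'} v → ms ≗ ms' → Φ ms v → Φ ms' v
    Sat⇔Φ    : ∀ G (ρ : Fin n → Unwound.UW G) v →
               IsValuation (λ j → Sat (asLc G) (β j) (proj₂ ∘ ρ)) v →
               Sat (uwStructure G) φ ρ ⇔ Φ (proj₁ ∘ ρ) v

  Φ-cong-⇔ : ∀ {ms ms'} v → ms ≗ ms' → Φ ms v ⇔ Φ ms' v
  Φ-cong-⇔ v eq = mk⇔ (Φ-cong v eq) (Φ-cong v (sym ∘ eq))

Reduction-cong : ∀ {n} {φ ψ : Formula LM n} →
                 (∀ G ρ → Sat (uwStructure G) φ ρ ⇔ Sat (uwStructure G) ψ ρ) →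
                 Reduction ψ → Reduction φ
Reduction-cong φ⇔ψ r = record
  { Reduction r
  ; Sat⇔Φ = λ G ρ v val → ⇔-trans (φ⇔ψ G ρ) (Sat⇔Φ G ρ v val)
  }
  where open Reduction r

reduce-≐ : ∀ {n} (a b : Fin n) → Reduction (var a ≐ var b)
reduce-≐ a b = record
  { size     = 1
  ; β        = (var a ≐ var b) ∷ []
  ; Φ        = λ ms v → ¬ ¬ (ms a ≡ ms b × T (v 0F))
  ; Φ-stable = λ _ _ → negated-stable
  ; Φ-cong   = λ v eq → ¬¬-map λ (k≡m , t) → trans (sym (eq a)) (trans k≡m (eq b)) , t
  ; Sat⇔Φ    = λ G ρ v val → ¬¬-cong
      (λ eq → pure (cong proj₁ eq , from (val 0F) (pure (cong proj₂ eq))))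
      (λ (k≡m , t) → ¬¬-map (cong₂ _,_ k≡m) (to (val 0F) t))
  }

reduce-M : ∀ {n} (xs : Fin 1 → Fin n) → Reduction (atom MM (var ∘ xs))
reduce-M xs = record
  { size     = 1
  ; β        = (var (xs 0F) ≐ e') ∷ []
  ; Φ        = λ ms v → T (v 0F)
  ; Φ-stable = λ _ v → decidable-stable (T? (v 0F))
  ; Φ-cong   = λ v eq t → t
  ; Sat⇔Φ    = λ G ρ v val → ⇔-sym (val 0F)
  }

LevelOrder : ℤ → ℤ → Bool → Bool → Bool → Set
LevelOrder k m same below atE = k ≡ m × T same ⊎ k < m ⊎ k ≡ m × (T below ⊎ T atE)

reduce-≤ : ∀ {n} (xs : Fin 2 → Fin n) → Reduction (atom leM (var ∘ xs))
reduce-≤ {n} xs = record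
  { size     = 3
  ; β        = β
  ; Φ        = λ ms v → ¬ ¬ LevelOrder (ms a) (ms b) (v 0F) (v 1F) (v 2F)
  ; Φ-stable = λ _ _ → negated-stable
  ; Φ-cong   = λ v eq → subst₂ (λ k m → ¬ ¬ LevelOrder k m (v 0F) (v 1F) (v 2F)) (eq a) (eq b)
  ; Sat⇔Φ    = λ G ρ v val → ¬¬-cong (sound G ρ v val) (complete G ρ v val)
  }
  where
  a b : Fin n
  a = xs 0F
  b = xs 1F
  β : Fin 3 → Formula Lc n
  β = (var a ≐ var b) ∷ R' e' (var a) (var b) ∷ (var a ≐ e') ∷ []
  module _ (G : CyclicallyOrderedGroup) (ρ : Fin n → Unwound.UW G) (v : Fin 3 → Bool)
           (val : IsValuation (λ j → Sat (asLc G) (β j) (proj₂ ∘ ρ)) v) where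
    open Unwound G
    sound : ρ a ≤uw ρ b → ¬ ¬ LevelOrder (proj₁ (ρ a)) (proj₁ (ρ b)) (v 0F) (v 1F) (v 2F)
    sound (inj₁ eq)                     = pure (inj₁ (cong proj₁ eq , from (val 0F) (pure (cong proj₂ eq))))
    sound (inj₂ (inj₁ k<m))             = pure (inj₂ (inj₁ k<m))
    sound (inj₂ (inj₂ (k≡m , inj₁ r)))  = pure (inj₂ (inj₂ (k≡m , inj₁ (from (val 1F) (pure r)))))
    sound (inj₂ (inj₂ (k≡m , inj₂ g≡e))) = pure (inj₂ (inj₂ (k≡m , inj₂ (from (val 2F) (pure g≡e)))))
    complete : LevelOrder (proj₁ (ρ a)) (proj₁ (ρ b)) (v 0F) (v 1F) (v 2F) → ¬ ¬ (ρ a ≤uw ρ b)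
    complete (inj₁ (k≡m , t))             = ¬¬-map (inj₁ ∘ cong₂ _,_ k≡m) (to (val 0F) t)
    complete (inj₂ (inj₁ k<m))            = pure (inj₂ (inj₁ k<m))
    complete (inj₂ (inj₂ (k≡m , inj₁ t))) = ¬¬-map (λ r → inj₂ (inj₂ (k≡m , inj₁ r))) (to (val 1F) t)
    complete (inj₂ (inj₂ (k≡m , inj₂ t))) = ¬¬-map (λ g≡e → inj₂ (inj₂ (k≡m , inj₂ g≡e))) (to (val 2F) t)

reduce-Mul : ∀ {n} (xs : Fin 3 → Fin n) → Reduction (atom mulM (var ∘ xs))
reduce-Mul {n} xs = record
  { size     = 2
  ; β        = β
  ; Φ        = λ ms v → ¬ ¬ (T (v 0F) × AddWithCarry (T (v 1F)) (ms a) (ms b) (ms c))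
  ; Φ-stable = λ _ _ → negated-stable
  ; Φ-cong   = λ v eq →
      subst₃ (λ k m n → ¬ ¬ (T (v 0F) × AddWithCarry (T (v 1F)) k m n)) (eq a) (eq b) (eq c)
  ; Sat⇔Φ    = Sat⇔Φ
  }
  where
  a b c : Fin n
  a = xs 0F
  b = xs 1F
  c = xs 2F
  β : Fin 2 → Formula Lc n
  β = (var c ≐ (var a ·' var b)) ∷ CarryFormula a b ∷ []
  Sat⇔Φ : ∀ G (ρ : Fin n → Unwound.UW G) v →
          IsValuation (λ j → Sat (asLc G) (β j) (proj₂ ∘ ρ)) v →
          Sat (uwStructure G) (atom mulM (var ∘ xs)) ρ ⇔
          (¬ ¬ (T (v 0F) × AddWithCarry (T (v 1F)) (proj₁ (ρ a)) (proj₁ (ρ b)) (proj₁ (ρ c))))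
  Sat⇔Φ G ρ v val = ¬¬-cong
    (λ mul → let (c≡ab , sum) = MulUW-sound (ρ a) (ρ b) (ρ c) mul
             in pure (from (val 0F) (pure c≡ab) , AddWithCarry-cong (⇔-sym T⇔Carry) sum))
    (λ (t , sum) → do
      c≡ab ← to (val 0F) t
      MulUW-complete (ρ a) (ρ b) (ρ c) (c≡ab , AddWithCarry-cong T⇔Carry sum))
    where
    open UnwoundProperties G
    T⇔Carry = ⇔-trans (val 1F) (Sat-CarryFormula G (proj₂ ∘ ρ) a b)

reduce-¬ : ∀ {n} {φ : Formula LM n} → Reduction φ → Reduction (¬' φ)
reduce-¬ r = record
  { size     = size
  ; β        = β
  ; Φ        = λ ms v → ¬ Φ ms v
  ; Φ-stable = λ _ _ → negated-stable
  ; Φ-cong   = λ v eq ¬Φ → ¬Φ ∘ Φ-cong v (sym ∘ eq)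
  ; Sat⇔Φ    = λ G ρ v val → ¬-cong-⇔ (Sat⇔Φ G ρ v val)
  }
  where open Reduction r

reduce-∧ : ∀ {n} {φ ψ : Formula LM n} → Reduction φ → Reduction ψ → Reduction (φ ∧' ψ)
reduce-∧ {n} r₁ r₂ = record
  { size     = R₁.size +ℕ R₂.size
  ; β        = R₁.β ++ R₂.β
  ; Φ        = λ ms v → R₁.Φ ms (left v) × R₂.Φ ms (right v)
  ; Φ-stable = λ ms v ¬¬Φ → R₁.Φ-stable ms (left v) (¬¬-map proj₁ ¬¬Φ) ,
                            R₂.Φ-stable ms (right v) (¬¬-map proj₂ ¬¬Φ)
  ; Φ-cong   = λ v eq (Φ₁ , Φ₂) → R₁.Φ-cong (left v) eq Φ₁ , R₂.Φ-cong (right v) eq Φ₂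
  ; Sat⇔Φ    = λ G ρ v val →
      R₁.Sat⇔Φ G ρ (left v) (λ j → subst (λ φ → TruthValue _ (Sat (asLc G) φ (proj₂ ∘ ρ)))
                                         (lookup-++ˡ R₁.β R₂.β j) (val (j ↑ˡ R₂.size))) ×-⇔
      R₂.Sat⇔Φ G ρ (right v) (λ j → subst (λ φ → TruthValue _ (Sat (asLc G) φ (proj₂ ∘ ρ)))
                                          (lookup-++ʳ R₁.β R₂.β j) (val (R₁.size ↑ʳ j)))
  }
  where
  module R₁ = Reduction r₁
  module R₂ = Reduction r₂
  left : (Fin (R₁.size +ℕ R₂.size) → Bool) → Fin R₁.size → Bool
  left v = v ∘ (_↑ˡ R₂.size)
  right : (Fin (R₁.size +ℕ R₂.size) → Bool) → Fin R₂.size → Bool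
  right v = v ∘ (R₁.size ↑ʳ_)

bits : ∀ {k} → Fin (2 ^ k) → Fin k → Bool
bits c = Inverse.to 2↔Bool ∘ finToFun c

bits-surjective : ∀ {k} (v : Fin k → Bool) → Σ (Fin (2 ^ k)) λ c → bits c ≗ v
bits-surjective v = funToFin (Inverse.from 2↔Bool ∘ v) , λ j →
  trans (cong (Inverse.to 2↔Bool) (finToFun-funToFin (Inverse.from 2↔Bool ∘ v) j))
        (Inverse.strictlyInverseˡ 2↔Bool (v j))

reduce-∀ : ∀ {n} {φ : Formula LM (suc n)} → Reduction φ → Reduction (∀' φ)
reduce-∀ {n} {φ} r = record
  { size     = 2 ^ size
  ; β        = β∀
  ; Φ        = Φ∀
  ; Φ-stable = λ ms w ¬¬Φ m c t → Φ-stable (m ∷ ms) (bits c) (¬¬-map (λ Φw → Φw m c t) ¬¬Φ)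
  ; Φ-cong   = λ w eq Φw m c t → Φ-cong (bits c) (∷-cong m eq) (Φw m c t)
  ; Sat⇔Φ    = Sat⇔Φ∀
  }
  where
  open Reduction r

  β∀ : Fin (2 ^ size) → Formula Lc n
  β∀ c = ∃' (⋀' λ j → literal (bits c j) (β j))

  Φ∀ : (Fin n → ℤ) → (Fin (2 ^ size) → Bool) → Set
  Φ∀ ms w = ∀ m c → T (w c) → Φ (m ∷ ms) (bits c)

  ∷-cong : ∀ {ms ms' : Fin n → ℤ} m → ms ≗ ms' → (m ∷ ms) ≗ (m ∷ ms')
  ∷-cong m eq zero    = refl
  ∷-cong m eq (suc i) = eq i

  module _ (G : CyclicallyOrderedGroup) (ρ : Fin n → Unwound.UW G) where
    open CyclicallyOrderedGroup G using (Carrier)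
    open CyclicOrderProperties G using (asLc-extensional)
    uw = uwStructure G
    gs = proj₂ ∘ ρ

    ValuationAt : Carrier → (Fin size → Bool) → Set
    ValuationAt g = IsValuation (λ j → Sat (asLc G) (β j) (extend (asLc G) g gs))

    Sat-β∀-body : ∀ c g → Sat (asLc G) (⋀' λ j → literal (bits c j) (β j)) (extend (asLc G) g gs) ⇔
                          ValuationAt g (bits c)
    Sat-β∀-body c g = ⇔-trans (Sat-⋀' (asLc G) _ _)
      (mk⇔ (λ s j → to (Sat-literal (asLc G) _ (β j) _) (s j))
           (λ tv j → from (Sat-literal (asLc G) _ (β j) _) (tv j)))

    Sat⇔Φ-extend : ∀ m g v → ValuationAt g v →
                   Sat uw φ (extend uw (m , g) ρ) ⇔ Φ (m ∷ proj₁ ∘ ρ) v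
    Sat⇔Φ-extend m g v val = ⇔-trans
      (Sat⇔Φ G (extend uw (m , g) ρ) v λ j →
        ⇔-trans (val j) (Sat-cong-⇔ (asLc G) asLc-extensional (β j) gs-extend))
      (Φ-cong-⇔ v ms-extend)
      where
      gs-extend : extend (asLc G) g gs ≗ proj₂ ∘ extend uw (m , g) ρ
      gs-extend zero    = refl
      gs-extend (suc i) = refl
      ms-extend : proj₁ ∘ extend uw (m , g) ρ ≗ m ∷ proj₁ ∘ ρ
      ms-extend zero    = refl
      ms-extend (suc i) = refl

    Sat⇔Φ∀ : ∀ w → IsValuation (λ c → Sat (asLc G) (β∀ c) gs) w →
             Sat uw (∀' φ) ρ ⇔ Φ∀ (proj₁ ∘ ρ) w
    Sat⇔Φ∀ w val = mk⇔ sound complete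
      where
      sound : Sat uw (∀' φ) ρ → Φ∀ (proj₁ ∘ ρ) w
      sound s m c t = Φ-stable _ _ λ ¬Φ → to (val c) t λ g realises-c →
        ¬Φ (to (Sat⇔Φ-extend m g (bits c) (to (Sat-β∀-body c g) realises-c)) (s (m , g)))
      complete : Φ∀ (proj₁ ∘ ρ) w → Sat uw (∀' φ) ρ
      complete Φw (m , g) = Sat-stable uw φ _ do
        (v , valv) ← ¬¬-valuation (λ j → Sat (asLc G) (β j) (extend (asLc G) g gs))
        let (c , bits-c≗v) = bits-surjective v
            valc : ValuationAt g (bits c)
            valc j = subst (λ b → TruthValue b _) (sym (bits-c≗v j)) (valv j)
            realises-c = ∃⟶¬∀¬ (g , from (Sat-β∀-body c g) valc)
        pure (from (Sat⇔Φ-extend m g (bits c) valc) (Φw m c (from (val c) realises-c)))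

toVar : ∀ {n} → Term LM n → Fin n
toVar (var i) = i

module _ (G : CyclicallyOrderedGroup) where
  open Unwound G using (UW)
  open Extensional (UnwoundProperties.uw-extensional G) using (rel-cong)

  private
    uw = uwStructure G

  eval-toVar : ∀ {n} (ρ : Fin n → UW) t → eval uw ρ t ≡ ρ (toVar t)
  eval-toVar ρ (var i) = refl

  Sat-≐-toVar : ∀ {n} (t u : Term LM n) ρ →
                Sat uw (t ≐ u) ρ ⇔ Sat uw (var (toVar t) ≐ var (toVar u)) ρ
  Sat-≐-toVar t u ρ = mk⇔
    (¬¬-map λ eq → trans (sym (eval-toVar ρ t)) (trans eq (eval-toVar ρ u)))
    (¬¬-map λ eq → trans (eval-toVar ρ t) (trans eq (sym (eval-toVar ρ u))))

  Sat-atom-toVar : ∀ {n} r (ts : Fin (Signature.rArity LM r) → Term LM n) ρ →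
                   Sat uw (atom r ts) ρ ⇔ Sat uw (atom r (var ∘ toVar ∘ ts)) ρ
  Sat-atom-toVar r ts ρ = mk⇔
    (¬¬-map (rel-cong r (eval-toVar ρ ∘ ts)))
    (¬¬-map (rel-cong r (sym ∘ eval-toVar ρ ∘ ts)))

reduce : ∀ {n} (φ : Formula LM n) → Reduction φ
reduce (t ≐ u)        = Reduction-cong (λ G → Sat-≐-toVar G t u) (reduce-≐ (toVar t) (toVar u))
reduce (atom mulM ts) = Reduction-cong (λ G → Sat-atom-toVar G mulM ts) (reduce-Mul (toVar ∘ ts))
reduce (atom leM ts)  = Reduction-cong (λ G → Sat-atom-toVar G leM ts) (reduce-≤ (toVar ∘ ts))
reduce (atom MM ts)   = Reduction-cong (λ G → Sat-atom-toVar G MM ts) (reduce-M (toVar ∘ ts))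
reduce (¬' φ)         = reduce-¬ (reduce φ)
reduce (φ ∧' ψ)       = reduce-∧ (reduce φ) (reduce ψ)
reduce (∀' φ)         = reduce-∀ (reduce φ)

Sat-uw-transfer : ∀ G G' {n} (φ : Formula LM n) →
                  (ρ : Fin n → Unwound.UW G) (ρ' : Fin n → Unwound.UW G') →
                  (∀ ψ → Sat (asLc G) ψ (proj₂ ∘ ρ) ⇔ Sat (asLc G') ψ (proj₂ ∘ ρ')) →
                  proj₁ ∘ ρ ≗ proj₁ ∘ ρ' →
                  Sat (uwStructure G) φ ρ ⇔ Sat (uwStructure G') φ ρ'
Sat-uw-transfer G G' φ ρ ρ' same-type same-levels =
  ¬¬-⇔ (Sat-stable (uwStructure G) φ ρ) (Sat-stable (uwStructure G') φ ρ') do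
    (v , val) ← ¬¬-valuation (λ j → Sat (asLc G) (β j) (proj₂ ∘ ρ))
    let val' = λ j → ⇔-trans (val j) (same-type (β j))
    pure (begin
      Sat (uwStructure G) φ ρ    ≈⟨ Sat⇔Φ G ρ v val ⟩
      Φ (proj₁ ∘ ρ) v            ≈⟨ Φ-cong-⇔ v same-levels ⟩
      Φ (proj₁ ∘ ρ') v           ≈⟨ Sat⇔Φ G' ρ' v val' ⟨
      Sat (uwStructure G') φ ρ'  ∎)
  where
  open Reduction (reduce φ)
  open ⇔-Reasoning

module _ (G G' : CyclicallyOrderedGroup) where
  open ⇔-Reasoning

  private
    uw  = uwStructure G
    uw' = uwStructure G'
    Sat-sentenceᴳ  = Sat-sentence (asLc G) (CyclicOrderProperties.asLc-extensional G)
    Sat-sentenceᴳ' = Sat-sentence (asLc G') (CyclicOrderProperties.asLc-extensional G')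

  uw-preserves-≡ₑ : asLc G ≡ₑ asLc G' → uw ≡ₑ uw'
  uw-preserves-≡ₑ G≡G' φ = Sat-uw-transfer G G' φ noVars noVars same-theory (λ ())
    where
    same-theory : ∀ ψ → Sat (asLc G) ψ (proj₂ ∘ noVars) ⇔ Sat (asLc G') ψ (proj₂ ∘ noVars)
    same-theory ψ = begin
      Sat (asLc G) ψ (proj₂ ∘ noVars)   ≈⟨ Sat-sentenceᴳ ψ (proj₂ ∘ noVars) ⟩
      Sat (asLc G) ψ noVars             ≈⟨ G≡G' ψ ⟩
      Sat (asLc G') ψ noVars            ≈⟨ Sat-sentenceᴳ' ψ (proj₂ ∘ noVars) ⟨
      Sat (asLc G') ψ (proj₂ ∘ noVars)  ∎

  uw-reflects-≡ₑ : uw ≡ₑ uw' → asLc G ≡ₑ asLc G'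
  uw-reflects-≡ₑ uw≡uw' φ = begin
    Sat (asLc G) φ noVars              ≈⟨ Sat-sentenceᴳ φ (proj₂ ∘ noVars) ⟨
    Sat (asLc G) φ (proj₂ ∘ noVars)    ≈⟨ Interpretation.Sat-translate G φ noVars ⟩
    Sat uw (translate φ) noVars        ≈⟨ uw≡uw' (translate φ) ⟩
    Sat uw' (translate φ) noVars       ≈⟨ Interpretation.Sat-translate G' φ noVars ⟨
    Sat (asLc G') φ (proj₂ ∘ noVars)   ≈⟨ Sat-sentenceᴳ' φ (proj₂ ∘ noVars) ⟩
    Sat (asLc G') φ noVars             ∎

  module _ (ι : CyclicallyOrderedGroup.Carrier G → CyclicallyOrderedGroup.Carrier G') where
    private
      uwι = uwMap {G} {G'} ι

    uw-preserves-≼ : ElementaryAlong (asLc G) (asLc G') ι → ElementaryAlong uw uw' uwι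
    uw-preserves-≼ G≼G' φ ρ = Sat-uw-transfer G G' φ ρ (uwι ∘ ρ) (λ ψ → G≼G' ψ (proj₂ ∘ ρ)) (λ _ → refl)

    uw-reflects-≼ : ElementaryAlong uw uw' uwι → ElementaryAlong (asLc G) (asLc G') ι
    uw-reflects-≼ uw≼uw' φ gs = begin
      Sat (asLc G) φ gs               ≈⟨ Interpretation.Sat-translate G φ ρ ⟩
      Sat uw (translate φ) ρ          ≈⟨ uw≼uw' (translate φ) ρ ⟩
      Sat uw' (translate φ) (uwι ∘ ρ) ≈⟨ Interpretation.Sat-translate G' φ (uwι ∘ ρ) ⟨
      Sat (asLc G') φ (ι ∘ gs)        ∎
      where
      ρ = λ i → (0ℤ , gs i)

lemma4p3 :
    ((G G' : CyclicallyOrderedGroup) →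
      (asLc G ≡ₑ asLc G') ⇔ (uwStructure G ≡ₑ uwStructure G'))
    ×
    ((G G' : CyclicallyOrderedGroup)
     (ι : CyclicallyOrderedGroup.Carrier G → CyclicallyOrderedGroup.Carrier G') →
     IsSubstructure G G' ι →
      ElementaryAlong (asLc G) (asLc G') ι
        ⇔ ElementaryAlong (uwStructure G) (uwStructure G') (uwMap {G} {G'} ι))
lemma4p3 =
  (λ G G' → mk⇔ (uw-preserves-≡ₑ G G') (uw-reflects-≡ₑ G G')) ,
  (λ G G' ι _ → mk⇔ (uw-preserves-≼ G G' ι) (uw-reflects-≼ G G' ι))
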